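{- Let $\mathbf{A}$ be a pointed lattice and $F$ a prime $\mathsf{1}$-filter of $\mathbf{A}$. Let $\Theta_+(F):=\mathrm{Cg}^{\mathbf{A}}\{\langle f\wedge\mathsf{1},\mathsf{1}\rangle: f\in F\}$. Then the positive kernel of $\Theta_+(F)$ is $F$, and $\Theta_+(F)\subseteq\phi$ for every congruence $\phi$ of $\mathbf{A}$ whose positive kernel is $F$.
   Context: A pointed lattice is a lattice with a constant $\mathsf{1}$. A $\mathsf{1}$-filter is a lattice filter (nonempty upset closed under binary meets) containing $\mathsf{1}$; it is prime if $a\vee b\in F$ implies $a\in F$ or $b\in F$. $\mathrm{Cg}^{\mathbf{A}}X$ is the congruence generated by $X$. The positive kernel of a congruence $\theta$ is $\{a\in\mathbf{A}: a/\theta\geq\mathsf{1}/\theta \text{ in } \mathbf{A}/\theta\}$. -}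

module Defs where

open import Level using (Level; _⊔_; suc)
open import Algebra.Lattice.Bundles using (Lattice)
open import Data.Product using (Σ; _×_; _,_)
open import Data.Sum using (_⊎_)

record PointedLattice (c ℓ : Level) : Set (suc (c ⊔ ℓ)) where
  field
    lattice : Lattice c ℓ
  open Lattice lattice public
  field
    𝟏 : Carrier

module _ {c ℓ : Level} (A : PointedLattice c ℓ) where
  open PointedLattice A

  _≤ₗ_ : Carrier → Carrier → Set ℓ
  a ≤ₗ b = (a ∧ b) ≈ a

  record IsOneFilter {ℓF : Level} (F : Carrier → Set ℓF) : Set (c ⊔ ℓ ⊔ ℓF) where
    field
      upward  : ∀ {a b} → F a → a ≤ₗ b → F b
      meet    : ∀ {a b} → F a → F b → F (a ∧ b)
      has-𝟏   : F 𝟏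

  record IsPrimeOneFilter {ℓF : Level} (F : Carrier → Set ℓF) : Set (c ⊔ ℓ ⊔ ℓF) where
    field
      isOneFilter : IsOneFilter F
      prime       : ∀ {a b} → F (a ∨ b) → F a ⊎ F b

  record IsCongruence {ℓθ : Level} (θ : Carrier → Carrier → Set ℓθ) : Set (c ⊔ ℓ ⊔ ℓθ) where
    field
      ≈⇒θ    : ∀ {a b} → a ≈ b → θ a b
      θ-sym   : ∀ {a b} → θ a b → θ b a
      θ-trans : ∀ {a b d} → θ a b → θ b d → θ a d
      ∧-comp  : ∀ {a b a' b'} → θ a a' → θ b b' → θ (a ∧ b) (a' ∧ b')
      ∨-comp  : ∀ {a b a' b'} → θ a a' → θ b b' → θ (a ∨ b) (a' ∨ b')

  data Cg {ℓX : Level} (X : Carrier → Carrier → Set ℓX) : Carrier → Carrier → Set (c ⊔ ℓ ⊔ ℓX) where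
    gen    : ∀ {a b} → X a b → Cg X a b
    eq     : ∀ {a b} → a ≈ b → Cg X a b
    sym′   : ∀ {a b} → Cg X a b → Cg X b a
    trans′ : ∀ {a b d} → Cg X a b → Cg X b d → Cg X a d
    ∧-c    : ∀ {a b a' b'} → Cg X a a' → Cg X b b' → Cg X (a ∧ b) (a' ∧ b')
    ∨-c    : ∀ {a b a' b'} → Cg X a a' → Cg X b b' → Cg X (a ∨ b) (a' ∨ b')

  -- positive kernel: a/θ ≥ 𝟏/θ in A/θ, i.e. (𝟏 ∧ a)/θ = 𝟏/θ
  PositiveKernel : {ℓθ : Level} → (Carrier → Carrier → Set ℓθ) → Carrier → Set ℓθ
  PositiveKernel θ a = θ (𝟏 ∧ a) 𝟏

  ΘGens : {ℓF : Level} → (Carrier → Set ℓF) → Carrier → Carrier → Set (c ⊔ ℓ ⊔ ℓF)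
  ΘGens F a b = Σ Carrier (λ f → F f × (a ≈ (f ∧ 𝟏)) × (b ≈ 𝟏))

  Θ₊ : {ℓF : Level} → (Carrier → Set ℓF) → Carrier → Carrier → Set (c ⊔ ℓ ⊔ ℓF)
  Θ₊ F = Cg (ΘGens F)

  _≐_ : {ℓ₁ ℓ₂ : Level} → (Carrier → Set ℓ₁) → (Carrier → Set ℓ₂) → Set (c ⊔ ℓ₁ ⊔ ℓ₂)
  P ≐ Q = ∀ a → (P a → Q a) × (Q a → P a)

{-# OPTIONS --safe #-}
-- A prime 1-filter F is a union of classes of Θ₊(F): the relation "F a ⇔ F b" is a
-- congruence (compatibility with ∨ is exactly primeness) containing the generators, so it
-- contains Θ₊(F). Hence 𝟏 ∧ a ≡ 𝟏 mod Θ₊(F) forces 𝟏 ∧ a ∈ F and so a ∈ F. Conversely,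
-- any congruence with positive kernel F already contains the generators of Θ₊(F).
module Submission where

open import Defs
open import Level using (Level)
open import Data.Product using (_×_; _,_; proj₂)
open import Data.Sum using ([_,_])
open import Function.Bundles using (_⇔_; mk⇔; Equivalence)
open import Function.Properties.Equivalence using (⇔-isEquivalence)
open import Relation.Binary.Structures using (IsEquivalence)
import Algebra.Lattice.Properties.Lattice as LatticeProperties
import Relation.Binary.Reasoning.Setoid as SetoidReasoning

module _ {c ℓ : Level} (A : PointedLattice c ℓ) where
  open PointedLattice A

  Cg-least : ∀ {ℓX ℓφ} {X : Carrier → Carrier → Set ℓX} {φ : Carrier → Carrier → Set ℓφ}
           → IsCongruence A φ → (∀ {a b} → X a b → φ a b)
           → ∀ {a b} → Cg A X a b → φ a b
  Cg-least {X = X} {φ} isCong X⊆φ = go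
    where
      open IsCongruence isCong
      go : ∀ {a b} → Cg A X a b → φ a b
      go (gen x)      = X⊆φ x
      go (eq a≈b)     = ≈⇒θ a≈b
      go (sym′ p)     = θ-sym (go p)
      go (trans′ p q) = θ-trans (go p) (go q)
      go (∧-c p q)    = ∧-comp (go p) (go q)
      go (∨-c p q)    = ∨-comp (go p) (go q)

  module OneFilterProperties {ℓF : Level} {F : Carrier → Set ℓF} (isFilter : IsOneFilter A F) where
    open IsOneFilter isFilter
    open LatticeProperties lattice using (∧-idem)
    open SetoidReasoning setoid

    ∈-resp-≈ : ∀ {a b} → a ≈ b → F a → F b
    ∈-resp-≈ {a} {b} a≈b Fa = upward Fa (begin
      a ∧ b  ≈⟨ ∧-congˡ a≈b ⟨
      a ∧ a  ≈⟨ ∧-idem a ⟩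
      a      ∎)

    ∧-∈ˡ : ∀ {a b} → F (a ∧ b) → F a
    ∧-∈ˡ {a} {b} Fab = upward Fab (begin
      (a ∧ b) ∧ a  ≈⟨ ∧-assoc a b a ⟩
      a ∧ (b ∧ a)  ≈⟨ ∧-congˡ (∧-comm b a) ⟩
      a ∧ (a ∧ b)  ≈⟨ ∧-assoc a a b ⟨
      (a ∧ a) ∧ b  ≈⟨ ∧-congʳ (∧-idem a) ⟩
      a ∧ b        ∎)

    ∧-∈ʳ : ∀ {a b} → F (a ∧ b) → F b
    ∧-∈ʳ {a} {b} Fab = ∧-∈ˡ (∈-resp-≈ (∧-comm a b) Fab)

    ∨-∈ˡ : ∀ {a b} → F a → F (a ∨ b)
    ∨-∈ˡ {a} {b} Fa = upward Fa (∧-absorbs-∨ a b)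

    ∨-∈ʳ : ∀ {a b} → F b → F (a ∨ b)
    ∨-∈ʳ {a} {b} Fb = ∈-resp-≈ (∨-comm b a) (∨-∈ˡ Fb)

  SameMembership : ∀ {ℓF} → (Carrier → Set ℓF) → Carrier → Carrier → Set ℓF
  SameMembership F a b = F a ⇔ F b

  module _ {ℓF : Level} {F : Carrier → Set ℓF} (isPrime : IsPrimeOneFilter A F) where
    open IsPrimeOneFilter isPrime
    open IsOneFilter isOneFilter
    open OneFilterProperties isOneFilter
    open IsEquivalence (⇔-isEquivalence {ℓ = ℓF}) using () renaming (sym to ⇔-sym; trans to ⇔-trans)
    open Equivalence using (to; from)

    ∧-resp-⇔ : ∀ {a b a′ b′} → F a ⇔ F a′ → F b ⇔ F b′ → F (a ∧ b) → F (a′ ∧ b′)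
    ∧-resp-⇔ a⇔a′ b⇔b′ Fab = meet (to a⇔a′ (∧-∈ˡ Fab)) (to b⇔b′ (∧-∈ʳ Fab))

    ∨-resp-⇔ : ∀ {a b a′ b′} → F a ⇔ F a′ → F b ⇔ F b′ → F (a ∨ b) → F (a′ ∨ b′)
    ∨-resp-⇔ a⇔a′ b⇔b′ Fab = [ (λ Fa → ∨-∈ˡ (to a⇔a′ Fa)) , (λ Fb → ∨-∈ʳ (to b⇔b′ Fb)) ] (prime Fab)

    sameMembership-isCongruence : IsCongruence A (SameMembership F)
    sameMembership-isCongruence = record
      { ≈⇒θ    = λ a≈b → mk⇔ (∈-resp-≈ a≈b) (∈-resp-≈ (sym a≈b))
      ; θ-sym   = ⇔-sym
      ; θ-trans = ⇔-trans
      ; ∧-comp  = λ p q → mk⇔ (∧-resp-⇔ p q) (∧-resp-⇔ (⇔-sym p) (⇔-sym q))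
      ; ∨-comp  = λ p q → mk⇔ (∨-resp-⇔ p q) (∨-resp-⇔ (⇔-sym p) (⇔-sym q))
      }

    Θ₊-sameMembership : ∀ {a b} → Θ₊ A F a b → F a ⇔ F b
    Θ₊-sameMembership = Cg-least sameMembership-isCongruence generator-sameMembership
      where
        generator-sameMembership : ∀ {a b} → ΘGens A F a b → F a ⇔ F b
        generator-sameMembership (f , Ff , a≈f∧𝟏 , b≈𝟏) =
          mk⇔ (λ _ → ∈-resp-≈ (sym b≈𝟏) has-𝟏)
              (λ _ → ∈-resp-≈ (sym a≈f∧𝟏) (meet Ff has-𝟏))

    positiveKernel-Θ₊ : _≐_ A (PositiveKernel A (Θ₊ A F)) F
    positiveKernel-Θ₊ a =
        (λ 𝟏∧a≡𝟏 → ∧-∈ʳ (from (Θ₊-sameMembership 𝟏∧a≡𝟏) has-𝟏))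
      , (λ Fa → trans′ (eq (∧-comm 𝟏 a)) (gen (a , Fa , refl , refl)))

  Θ₊-least : ∀ {ℓF ℓφ} {F : Carrier → Set ℓF} (φ : Carrier → Carrier → Set ℓφ)
           → IsCongruence A φ → _≐_ A (PositiveKernel A φ) F
           → ∀ a b → Θ₊ A F a b → φ a b
  Θ₊-least φ isCong kerφ≐F _ _ = Cg-least isCong generator∈φ
    where
      open IsCongruence isCong
      generator∈φ : ∀ {a b} → ΘGens A _ a b → φ a b
      generator∈φ (f , Ff , a≈f∧𝟏 , b≈𝟏) =
        θ-trans (≈⇒θ (trans a≈f∧𝟏 (∧-comm f 𝟏)))
                (θ-trans (proj₂ (kerφ≐F f) Ff) (≈⇒θ (sym b≈𝟏)))

lemma2p7 : {c ℓ ℓF ℓφ : Level} (A : PointedLattice c ℓ) (F : PointedLattice.Carrier A → Set ℓF)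
    → IsPrimeOneFilter A F
    → _≐_ A (PositiveKernel A (Θ₊ A F)) F
      × ((φ : PointedLattice.Carrier A → PointedLattice.Carrier A → Set ℓφ)
           → IsCongruence A φ → _≐_ A (PositiveKernel A φ) F
           → ∀ a b → Θ₊ A F a b → φ a b)
lemma2p7 A F isPrime = positiveKernel-Θ₊ A isPrime , Θ₊-least A
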